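{- Let $H$ be a graph with a legal colouring $c$ that contains a clique $\{x_1,x_2,x_3,y\}$ on four vertices. Then $H$ has a legal colouring $c'$ in which the triangle $x_1x_2x_3x_1$ is not monochromatic (i.e. its three edges do not all receive the same colour).
   Context: All graphs are finite and simple. A legal colouring of a graph $H$ is a map $c:E(H)\to\{1,\ldots,\lfloor (|V(H)|-1)/2\rfloor\}$ such that every nonempty colour class $c^{ -1}(i)$ is the edge set of a cycle of $H$. -}

module Defs where

open import Data.Nat using (ℕ; zero; suc; _∸_; _≟_)
open import Data.Nat.DivMod using (_/_)
open import Data.Fin using (Fin; zero; suc; toℕ; lower₁)
open import Data.Product using (Σ; _×_; ∃; _,_)
open import Data.Sum using (_⊎_)
open import Relation.Binary.PropositionalEquality using (_≡_)
open import Relation.Nullary using (¬_; yes; no)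
open import Function.Definitions using (Injective)

record Graph (n : ℕ) : Set₁ where
  field
    Adj     : Fin n → Fin n → Set
    symAdj  : ∀ {u v} → Adj u v → Adj v u
    irrefl  : ∀ {u} → ¬ Adj u u
open Graph public

-- Number of available colours: ⌊(|V(H)| - 1)/2⌋ (colours are Fin numColours,
-- i.e. 0,...,k-1 instead of 1,...,k).
numColours : ℕ → ℕ
numColours n = (n ∸ 1) / 2

-- An edge colouring: assigns a colour to each edge, independently of
-- orientation (and of the adjacency proof).
record EdgeColouring {n : ℕ} (H : Graph n) : Set where
  field
    col    : (u v : Fin n) → Adj H u v → Fin (numColours n)
    colSym : ∀ u v (p : Adj H u v) (q : Adj H v u) → col u v p ≡ col v u q
open EdgeColouring public

next : ∀ {m} → Fin (suc m) → Fin (suc m)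
next {m} i with m ≟ toℕ i
... | yes _  = zero
... | no ne = suc (lower₁ i ne)

-- A set S of (oriented, symmetric) vertex pairs is the edge set of a cycle
-- of length m+3 ≥ 3: there are distinct vertices f 0,...,f (m+2) such that
-- consecutive ones (cyclically) are in S, and every pair in S is such a
-- consecutive pair.
IsCycleEdgeSet : ∀ {n} → (Fin n → Fin n → Set) → Set
IsCycleEdgeSet {n} S =
  Σ ℕ λ m → Σ (Fin (suc (suc (suc m))) → Fin n) λ f →
    Injective _≡_ _≡_ f
    × (∀ i → S (f i) (f (next i)))
    × (∀ u v → S u v → ∃ λ i → (u ≡ f i × v ≡ f (next i)) ⊎ (v ≡ f i × u ≡ f (next i)))

ColourClass : ∀ {n} {H : Graph n} → EdgeColouring H → Fin (numColours n) → Fin n → Fin n → Set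
ColourClass {H = H} c i u v = Σ (Adj H u v) λ p → col c u v p ≡ i

Legal : ∀ {n} {H : Graph n} → EdgeColouring H → Set
Legal {n} c = ∀ (i : Fin (numColours n)) →
  (∃ λ u → ∃ λ v → ColourClass c i u v) → IsCycleEdgeSet (ColourClass c i)

module Submission where

-- Suppose the triangle x₁x₂x₃ is monochromatic, of colour i. The colour class of i is a cycle
-- containing the triangle, so it is the triangle T itself. Let Cₐ and C_b be the colour classes
-- of x₁y and x₂y; their colours a and b differ from i because y lies off T. If Cₐ passes through
-- x₂ or x₃, then T ∪ Cₐ is also the edge-disjoint union of two other cycles, each containing an
-- edge of T (Cₐ meets T in two or in three vertices); likewise for C_b. Otherwise T ∪ Cₐ ∪ C_b
-- is the edge-disjoint union of the cycles x₂x₁Cₐyx₂ and x₁x₃x₂C_byx₁. In every case, giving the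
-- two new cycles two distinct colours among i, a, b yields a legal colouring in which T is not
-- monochromatic.

open import Defs
open import Data.Nat using (ℕ)
open import Data.Fin using (Fin)
open import Data.Product using (Σ; _×_)
open import Relation.Binary.PropositionalEquality using (_≡_)
open import Relation.Nullary using (¬_)

open import Level using (0ℓ)
open import Function using (id; _∘_)
open import Data.Bool using (Bool; true; false)
open import Data.Empty using (⊥; ⊥-elim)
open import Data.Nat as ℕ using (zero; suc)
open import Data.Fin using (zero; suc; toℕ; fromℕ; inject₁)
open import Data.Fin.Properties using (toℕ-fromℕ; toℕ-inject₁-≢; lower₁-inject₁′) renaming (_≟_ to _≟ᶠ_)
open import Data.Product as Product using (∃; ∃₂; _,_; proj₁; proj₂)
open import Data.Sum as Sum using (_⊎_; inj₁; inj₂; [_,_]′; map₁; map₂)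
open import Data.List using (List; []; _∷_; _++_; [_]; reverse; tabulate; lookup)
open import Data.List.Properties
  using (++-assoc; ++-identityʳ; ++-conicalˡ; ++-conicalʳ; ∷ʳ-injectiveˡ; ∷-injectiveʳ; reverse-++; unfold-reverse; reverse-involutive; tabulate-lookup)
open import Data.List.Membership.Propositional using (_∈_; _∉_)
open import Data.List.Membership.Propositional.Properties using (∈-++⁻; ∈-++⁺ʳ; ∈-lookup)
open import Data.List.Relation.Unary.Any using (here; there)
import Data.List.Relation.Unary.AllPairs as AllPairs
open import Data.List.Relation.Unary.All.Properties using (¬Any⇒All¬)
open import Data.List.Relation.Unary.Unique.Propositional using (Unique)
open import Data.List.Relation.Unary.Unique.Propositional.Properties using (tabulate⁺; Unique[x∷xs]⇒x∉xs)
open import Data.List.Relation.Binary.Permutation.Propositional using (_↭_; ↭-sym; ↭⇒↭ₛ)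
open import Data.List.Relation.Binary.Permutation.Propositional.Properties using (↭-reverse; ++-comm)
import Data.List.Relation.Binary.Permutation.Setoid.Properties as Permutationₛ
open import Data.List.Relation.Binary.Sublist.Propositional as Sublist using (_⊆_; ⊆-refl; minimum)
open import Data.List.Relation.Binary.Sublist.Propositional.Properties using (++⁺ˡ; ++⁺ʳ; ++⁺; Any-resp-⊆; All-resp-⊆)
open import Relation.Binary.Core using (Rel; _⇒_; _⇔_)
open import Relation.Binary.Definitions using (Symmetric; Decidable; DecidableEquality)
open import Relation.Binary.Construct.Union using (_∪_)
open import Relation.Binary.PropositionalEquality using (_≢_; ≢-sym; refl; sym; trans; cong; cong₂; subst; setoid)
open import Relation.Nullary using (Dec; yes; no)
open import Relation.Nullary.Decidable using (_×-dec_; _⊎-dec_; does; dec-true; dec-false)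
import Relation.Unary as U
open import Relation.Unary.Properties using (_∪?_)

module _ {A : Set} where

  ++-∷≢[] : ∀ xs {x : A} {ys} → xs ++ x ∷ ys ≢ []
  ++-∷≢[] []      ()
  ++-∷≢[] (_ ∷ _) ()

  reverse-∷∷ : ∀ (a b : A) l → reverse (a ∷ b ∷ l) ≡ reverse l ++ b ∷ [ a ]
  reverse-∷∷ a b l = trans (unfold-reverse a (b ∷ l))
                      (trans (cong (_++ [ a ]) (unfold-reverse b l)) (++-assoc (reverse l) [ b ] [ a ]))

  reverse-vertices : ∀ (s : A) M t → reverse (s ∷ M ++ [ t ]) ≡ t ∷ reverse M ++ [ s ]
  reverse-vertices s M t = trans (unfold-reverse s (M ++ [ t ])) (cong (_++ [ s ]) (reverse-++ M [ t ]))

  Unique-resp-↭ : ∀ {xs ys : List A} → xs ↭ ys → Unique xs → Unique ys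
  Unique-resp-↭ σ = Permutationₛ.Unique-resp-↭ (setoid A) (↭⇒↭ₛ σ)

  Unique-resp-⊇ : ∀ {xs ys : List A} → xs ⊆ ys → Unique ys → Unique xs
  Unique-resp-⊇ Sublist.[]           _   = AllPairs.[]
  Unique-resp-⊇ (_ Sublist.∷ʳ τ)    !ys = Unique-resp-⊇ τ (AllPairs.tail !ys)
  Unique-resp-⊇ (refl Sublist.∷ τ) !ys = All-resp-⊆ τ (AllPairs.head !ys) AllPairs.∷ Unique-resp-⊇ τ (AllPairs.tail !ys)

  Unique-∷ : ∀ {x} {xs : List A} → x ∉ xs → Unique xs → Unique (x ∷ xs)
  Unique-∷ {xs = xs} x∉xs !xs = ¬Any⇒All¬ xs x∉xs AllPairs.∷ !xs

  shared-vertex : ∀ (xs : List A) {w ys x} → Unique (xs ++ w ∷ ys) → x ∈ xs ++ [ w ] → x ∈ w ∷ ys → x ≡ w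
  shared-vertex []       _  (here x≡w)  _    = x≡w
  shared-vertex (a ∷ xs) !l (here refl) x∈ys = ⊥-elim (Unique[x∷xs]⇒x∉xs !l (∈-++⁺ʳ xs x∈ys))
  shared-vertex (a ∷ xs) !l (there x∈)  x∈ys = shared-vertex xs (AllPairs.tail !l) x∈ x∈ys

  ∈-split : ∀ {u} {xs : List A} ys → u ∈ xs → ∃₂ λ p q → xs ++ ys ≡ p ++ u ∷ q ++ ys
  ∈-split ys (here refl) = [] , _ , refl
  ∈-split ys (there u∈) with ∈-split ys u∈
  ... | p , q , eq = _ ∷ p , q , cong (_ ∷_) eq

  ∈-split₂ : ∀ {u v} {xs : List A} ys → u ∈ xs → v ∈ xs → u ≢ v →
             (∃₂ λ p q → ∃ λ r → xs ++ ys ≡ p ++ u ∷ q ++ v ∷ r ++ ys) ⊎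
             (∃₂ λ p q → ∃ λ r → xs ++ ys ≡ p ++ v ∷ q ++ u ∷ r ++ ys)
  ∈-split₂ ys (here refl) (here refl) u≢v = ⊥-elim (u≢v refl)
  ∈-split₂ ys (here refl) (there v∈)  _   with ∈-split ys v∈
  ... | q , r , eq = inj₁ ([] , q , r , cong (_ ∷_) eq)
  ∈-split₂ ys (there u∈)  (here refl) _   with ∈-split ys u∈
  ... | q , r , eq = inj₂ ([] , q , r , cong (_ ∷_) eq)
  ∈-split₂ ys (there u∈)  (there v∈)  u≢v with ∈-split₂ ys u∈ v∈ u≢v
  ... | inj₁ (p , q , r , eq) = inj₁ (_ ∷ p , q , r , cong (_ ∷_) eq)
  ... | inj₂ (p , q , r , eq) = inj₂ (_ ∷ p , q , r , cong (_ ∷_) eq)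

  lookup-injective : ∀ {l : List A} → Unique l → ∀ {i j} → lookup l i ≡ lookup l j → i ≡ j
  lookup-injective {a ∷ l} _  {zero}  {zero}  _  = refl
  lookup-injective {a ∷ l} !l {zero}  {suc j} eq = ⊥-elim (Unique[x∷xs]⇒x∉xs !l (subst (_∈ l) (sym eq) (∈-lookup j)))
  lookup-injective {a ∷ l} !l {suc i} {zero}  eq = ⊥-elim (Unique[x∷xs]⇒x∉xs !l (subst (_∈ l) eq (∈-lookup i)))
  lookup-injective {a ∷ l} !l {suc i} {suc j} eq = cong suc (lookup-injective (AllPairs.tail !l) eq)

  tabulate-∷ʳ : ∀ k (g : Fin (suc k) → A) → tabulate g ≡ tabulate (g ∘ inject₁) ++ [ g (fromℕ k) ]
  tabulate-∷ʳ zero    g = refl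
  tabulate-∷ʳ (suc k) g = cong (g zero ∷_) (tabulate-∷ʳ k (g ∘ suc))

-- Edge sets of paths and closed walks

module _ {A : Set} where

  Disjoint : Rel A 0ℓ → Rel A 0ℓ → Set
  Disjoint R S = ∀ {u v} → R u v → S u v → ⊥

  Meets : Rel A 0ℓ → Rel A 0ℓ → Set
  Meets R S = ∃₂ λ u v → R u v × S u v

  ⇔-trans : ∀ {R S T : Rel A 0ℓ} → R ⇔ S → S ⇔ T → R ⇔ T
  ⇔-trans (R⇒S , S⇒R) (S⇒T , T⇒S) = (λ r → S⇒T (R⇒S r)) , (λ t → S⇒R (T⇒S t))

  ∪-⇔ : ∀ {R R′ S S′ : Rel A 0ℓ} → R ⇔ R′ → S ⇔ S′ → R ∪ S ⇔ R′ ∪ S′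
  ∪-⇔ (R⇒R′ , R′⇒R) (S⇒S′ , S′⇒S) = Sum.map R⇒R′ S⇒S′ , Sum.map R′⇒R S′⇒S

  Link : A → A → Rel A 0ℓ
  Link a b u v = (u ≡ a × v ≡ b) ⊎ (u ≡ b × v ≡ a)

  Link-sym : ∀ {a b} → Symmetric (Link a b)
  Link-sym (inj₁ (p , q)) = inj₂ (q , p)
  Link-sym (inj₂ (p , q)) = inj₁ (q , p)

  Link-comm : ∀ {a b} → Link a b ⇒ Link b a
  Link-comm = Sum.swap

  Link-≡ʳ : ∀ {a b b′} → b ≡ b′ → Link a b ⇒ Link a b′
  Link-≡ʳ refl e = e

  Link-∩ : ∀ {a b c d u v} → Link a b u v → Link c d u v → (a ≡ c × b ≡ d) ⊎ (a ≡ d × b ≡ c)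
  Link-∩ (inj₁ (refl , refl)) (inj₁ (refl , refl)) = inj₁ (refl , refl)
  Link-∩ (inj₁ (refl , refl)) (inj₂ (refl , refl)) = inj₂ (refl , refl)
  Link-∩ (inj₂ (refl , refl)) (inj₁ (refl , refl)) = inj₂ (refl , refl)
  Link-∩ (inj₂ (refl , refl)) (inj₂ (refl , refl)) = inj₁ (refl , refl)

  Link-endpoint : ∀ {a b u v} → Link a b u v → a ≡ u ⊎ a ≡ v
  Link-endpoint (inj₁ (refl , _)) = inj₁ refl
  Link-endpoint (inj₂ (_ , refl)) = inj₂ refl

  Link∉ : ∀ {a b} {l : List A} {R : Rel A 0ℓ} → (∀ {u v} → R u v → u ∈ l × v ∈ l) → a ∉ l → Disjoint (Link a b) R
  Link∉ R⊆l a∉l ab r with Link-endpoint ab | R⊆l r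
  ... | inj₁ refl | u∈ , _ = a∉l u∈
  ... | inj₂ refl | _ , v∈ = a∉l v∈

  Triangle : A → A → A → Rel A 0ℓ
  Triangle a b c = Link a b ∪ Link b c ∪ Link a c

  Triangle-swap₁₂ : ∀ {a b c} → Triangle a b c ⇒ Triangle b a c
  Triangle-swap₁₂ (inj₁ ab)        = inj₁ (Link-comm ab)
  Triangle-swap₁₂ (inj₂ (inj₁ bc)) = inj₂ (inj₂ bc)
  Triangle-swap₁₂ (inj₂ (inj₂ ac)) = inj₂ (inj₁ ac)

  Triangle-swap₂₃ : ∀ {a b c} → Triangle a b c ⇒ Triangle a c b
  Triangle-swap₂₃ (inj₁ ab)        = inj₂ (inj₂ ab)
  Triangle-swap₂₃ (inj₂ (inj₁ bc)) = inj₂ (inj₁ (Link-comm bc))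
  Triangle-swap₂₃ (inj₂ (inj₂ ac)) = inj₁ ac

  Triangle-∈ : ∀ {a b c u v} → Triangle a b c u v → v ∈ a ∷ b ∷ [ c ]
  Triangle-∈ (inj₁ (inj₁ (_ , refl)))        = there (here refl)
  Triangle-∈ (inj₁ (inj₂ (_ , refl)))        = here refl
  Triangle-∈ (inj₂ (inj₁ (inj₁ (_ , refl)))) = there (there (here refl))
  Triangle-∈ (inj₂ (inj₁ (inj₂ (_ , refl)))) = there (here refl)
  Triangle-∈ (inj₂ (inj₂ (inj₁ (_ , refl)))) = there (there (here refl))
  Triangle-∈ (inj₂ (inj₂ (inj₂ (_ , refl)))) = here refl

  PathEdges : List A → Rel A 0ℓ
  PathEdges (a ∷ b ∷ l) = Link a b ∪ PathEdges (b ∷ l)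
  PathEdges _           = λ _ _ → ⊥

  PathEdges-≡ : ∀ {l l′} → l ≡ l′ → PathEdges l ⇒ PathEdges l′
  PathEdges-≡ refl e = e

  PathEdges-sym : ∀ l → Symmetric (PathEdges l)
  PathEdges-sym (a ∷ b ∷ l) (inj₁ e) = inj₁ (Link-sym e)
  PathEdges-sym (a ∷ b ∷ l) (inj₂ e) = inj₂ (PathEdges-sym (b ∷ l) e)

  PathEdges-∈ : ∀ l {u v} → PathEdges l u v → u ∈ l × v ∈ l
  PathEdges-∈ (a ∷ b ∷ l) (inj₁ (inj₁ (refl , refl))) = here refl , there (here refl)
  PathEdges-∈ (a ∷ b ∷ l) (inj₁ (inj₂ (refl , refl))) = there (here refl) , here refl
  PathEdges-∈ (a ∷ b ∷ l) (inj₂ e) with PathEdges-∈ (b ∷ l) e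
  ... | u∈ , v∈ = there u∈ , there v∈

  PathEdges-≢ : ∀ {l u v} → Unique l → PathEdges l u v → u ≢ v
  PathEdges-≢ {a ∷ b ∷ l} !l (inj₁ (inj₁ (refl , refl))) refl = Unique[x∷xs]⇒x∉xs !l (here refl)
  PathEdges-≢ {a ∷ b ∷ l} !l (inj₁ (inj₂ (refl , refl))) refl = Unique[x∷xs]⇒x∉xs !l (here refl)
  PathEdges-≢ {a ∷ b ∷ l} !l (inj₂ e)                        = PathEdges-≢ (AllPairs.tail !l) e

  PathEdges-split : ∀ xs {w ys} → PathEdges (xs ++ w ∷ ys) ⇒ PathEdges (xs ++ [ w ]) ∪ PathEdges (w ∷ ys)
  PathEdges-split []           e        = inj₂ e
  PathEdges-split (a ∷ [])     (inj₁ e) = inj₁ (inj₁ e)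
  PathEdges-split (a ∷ [])     (inj₂ e) = inj₂ e
  PathEdges-split (a ∷ b ∷ xs) (inj₁ e) = inj₁ (inj₁ e)
  PathEdges-split (a ∷ b ∷ xs) (inj₂ e) with PathEdges-split (b ∷ xs) e
  ... | inj₁ e′ = inj₁ (inj₂ e′)
  ... | inj₂ e′ = inj₂ e′

  PathEdges-join : ∀ xs {w ys} → PathEdges (xs ++ [ w ]) ∪ PathEdges (w ∷ ys) ⇒ PathEdges (xs ++ w ∷ ys)
  PathEdges-join []           (inj₂ e)          = e
  PathEdges-join (a ∷ [])     (inj₁ (inj₁ e))   = inj₁ e
  PathEdges-join (a ∷ [])     (inj₂ e)          = inj₂ e
  PathEdges-join (a ∷ b ∷ xs) (inj₁ (inj₁ e))   = inj₁ e
  PathEdges-join (a ∷ b ∷ xs) (inj₁ (inj₂ e))   = inj₂ (PathEdges-join (b ∷ xs) (inj₁ e))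
  PathEdges-join (a ∷ b ∷ xs) (inj₂ e)          = inj₂ (PathEdges-join (b ∷ xs) (inj₂ e))

  PathEdges-halves-disjoint : ∀ (xs : List A) {w ys} → Unique (xs ++ w ∷ ys) →
                              Disjoint (PathEdges (xs ++ [ w ])) (PathEdges (w ∷ ys))
  PathEdges-halves-disjoint xs {w} {ys} !l e₁ e₂ with PathEdges-∈ (xs ++ [ w ]) e₁ | PathEdges-∈ (w ∷ ys) e₂
  ... | u∈₁ , v∈₁ | u∈₂ , v∈₂ =
    PathEdges-≢ (Unique-resp-⊇ (++⁺ˡ xs ⊆-refl) !l) e₂
      (trans (shared-vertex xs !l u∈₁ u∈₂) (sym (shared-vertex xs !l v∈₁ v∈₂)))

  PathEdges-reverse⁻ : ∀ l → PathEdges (reverse l) ⇒ PathEdges l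
  PathEdges-reverse⁻ (a ∷ b ∷ l) e =
    [ (λ e′ → inj₂ (PathEdges-reverse⁻ (b ∷ l) (PathEdges-≡ (sym (unfold-reverse b l)) e′)))
    , (λ { (inj₁ e′) → inj₁ (Link-comm e′) })
    ]′ (PathEdges-split (reverse l) (PathEdges-≡ (reverse-∷∷ a b l) e))

  PathEdges-reverse⁺ : ∀ l → PathEdges l ⇒ PathEdges (reverse l)
  PathEdges-reverse⁺ l e = PathEdges-reverse⁻ (reverse l) (PathEdges-≡ (sym (reverse-involutive l)) e)

  PathEdges-∃ : ∀ l {u v} → PathEdges l u v → ∃₂ λ p a → ∃₂ λ b q → l ≡ p ++ a ∷ b ∷ q × Link a b u v
  PathEdges-∃ (a ∷ b ∷ l) (inj₁ e) = [] , a , b , l , refl , e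
  PathEdges-∃ (a ∷ b ∷ l) (inj₂ e) with PathEdges-∃ (b ∷ l) e
  ... | p , a′ , b′ , q , eq , e′ = a ∷ p , a′ , b′ , q , cong (a ∷_) eq , e′

  RingEdges : List A → Rel A 0ℓ
  RingEdges []      = λ _ _ → ⊥
  RingEdges (a ∷ l) = PathEdges (a ∷ l ++ [ a ])

  RingEdges-≡ : ∀ {l l′} → l ≡ l′ → RingEdges l ⇒ RingEdges l′
  RingEdges-≡ refl e = e

  RingEdges-closing : ∀ s M t → RingEdges (s ∷ M ++ [ t ]) ⇔ PathEdges (s ∷ M ++ [ t ]) ∪ Link s t
  RingEdges-closing s M t = to , from
    where
    ring : s ∷ (M ++ [ t ]) ++ [ s ] ≡ (s ∷ M) ++ t ∷ [ s ]
    ring = cong (s ∷_) (++-assoc M [ t ] [ s ])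
    to : RingEdges (s ∷ M ++ [ t ]) ⇒ PathEdges (s ∷ M ++ [ t ]) ∪ Link s t
    to e with PathEdges-split (s ∷ M) (PathEdges-≡ ring e)
    ... | inj₁ e′        = inj₁ e′
    ... | inj₂ (inj₁ e′) = inj₂ (Link-comm e′)
    from : PathEdges (s ∷ M ++ [ t ]) ∪ Link s t ⇒ RingEdges (s ∷ M ++ [ t ])
    from (inj₁ e) = PathEdges-≡ (sym ring) (PathEdges-join (s ∷ M) (inj₁ e))
    from (inj₂ e) = PathEdges-≡ (sym ring) (PathEdges-join (s ∷ M) (inj₂ (inj₁ (Link-comm e))))

  RingEdges-rotate : ∀ xs ys → RingEdges (xs ++ ys) ⇒ RingEdges (ys ++ xs)
  RingEdges-rotate [] ys e rewrite ++-identityʳ ys = e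
  RingEdges-rotate (a ∷ xs) [] e rewrite ++-identityʳ xs = e
  RingEdges-rotate (a ∷ xs) (b ∷ ys) e
    with PathEdges-split (a ∷ xs) (PathEdges-≡ (cong (a ∷_) (++-assoc xs (b ∷ ys) [ a ])) e)
  ... | inj₁ e′ = PathEdges-≡ (cong (b ∷_) (sym (++-assoc ys (a ∷ xs) [ b ]))) (PathEdges-join (b ∷ ys) (inj₂ e′))
  ... | inj₂ e′ = PathEdges-≡ (cong (b ∷_) (sym (++-assoc ys (a ∷ xs) [ b ]))) (PathEdges-join (b ∷ ys) (inj₁ e′))

-- Cycles

module _ {A : Set} where

  record Cycle (s t : A) : Set where
    field
      inner    : List A
      inner≢[] : inner ≢ []
      distinct : Unique (s ∷ inner ++ [ t ])

    vertices : List A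
    vertices = s ∷ inner ++ [ t ]

    edges : Rel A 0ℓ
    edges = PathEdges vertices ∪ Link s t

  open Cycle public

  edges-∈ : ∀ {s t : A} (C : Cycle s t) {u v} → edges C u v → u ∈ vertices C × v ∈ vertices C
  edges-∈ C (inj₁ e)                   = PathEdges-∈ (vertices C) e
  edges-∈ C (inj₂ (inj₁ (refl , refl))) = here refl , there (∈-++⁺ʳ (inner C) (here refl))
  edges-∈ C (inj₂ (inj₂ (refl , refl))) = there (∈-++⁺ʳ (inner C) (here refl)) , here refl

  edges-sym : ∀ {s t : A} (C : Cycle s t) → Symmetric (edges C)
  edges-sym C (inj₁ e) = inj₁ (PathEdges-sym (vertices C) e)
  edges-sym C (inj₂ e) = inj₂ (Link-sym e)

  ∉-vertices : ∀ {s t v : A} (C : Cycle s t) → v ≢ s → v ∉ inner C → v ≢ t → v ∉ vertices C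
  ∉-vertices C v≢s v∉M v≢t (here v≡s)  = v≢s v≡s
  ∉-vertices C v≢s v∉M v≢t (there v∈) with ∈-++⁻ (inner C) v∈
  ... | inj₁ v∈M        = v∉M v∈M
  ... | inj₂ (here v≡t) = v≢t v≡t

  closing-disjoint : ∀ {s t : A} (C : Cycle s t) → Disjoint (PathEdges (vertices C)) (Link s t)
  closing-disjoint {s} {t} C = closing (inner C) (inner≢[] C) (distinct C)
    where
    closing : ∀ M → M ≢ [] → Unique (s ∷ M ++ [ t ]) → Disjoint (PathEdges (s ∷ M ++ [ t ])) (Link s t)
    closing []      M≢[] _  _         _  = M≢[] refl
    closing (m ∷ M) _    !l (inj₁ sm) st with Link-∩ sm st
    ... | inj₁ (_ , m≡t) = Unique[x∷xs]⇒x∉xs (AllPairs.tail !l) (∈-++⁺ʳ M (here m≡t))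
    ... | inj₂ (s≡t , _) = Unique[x∷xs]⇒x∉xs !l (∈-++⁺ʳ (m ∷ M) (here s≡t))
    closing (m ∷ M) _    !l (inj₂ e)  st = Link∉ (PathEdges-∈ (m ∷ M ++ [ t ])) (Unique[x∷xs]⇒x∉xs !l) st e

  cycle-through-triangle : ∀ {a b c} (C : Cycle a b) → edges C a c → edges C c b → edges C ⇒ Triangle a b c
  cycle-through-triangle {a} {b} {c} C ac cb e = triangle (subst (λ M → Edges M _ _) (inner≡[c] (inner C) (distinct C) ac cb) e)
    where
    Edges : List A → Rel A 0ℓ
    Edges M = PathEdges (a ∷ M ++ [ b ]) ∪ Link a b

    triangle : Edges [ c ] ⇒ Triangle a b c
    triangle (inj₁ (inj₁ ac))         = inj₂ (inj₂ ac)
    triangle (inj₁ (inj₂ (inj₁ cb)))  = inj₂ (inj₁ (Link-comm cb))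
    triangle (inj₂ ab)                = inj₁ ab

    a≢b : ∀ M → Unique (a ∷ M ++ [ b ]) → a ≢ b
    a≢b M !l a≡b = Unique[x∷xs]⇒x∉xs !l (∈-++⁺ʳ M (here a≡b))

    irreflexive : ∀ M → Unique (a ∷ M ++ [ b ]) → ∀ {u v} → Edges M u v → u ≢ v
    irreflexive M !l (inj₁ e)                    = PathEdges-≢ !l e
    irreflexive M !l (inj₂ (inj₁ (refl , refl))) = a≢b M !l
    irreflexive M !l (inj₂ (inj₂ (refl , refl))) = a≢b M !l ∘ sym

    b-follows-c : ∀ M → Unique (a ∷ c ∷ M ++ [ b ]) → Edges (c ∷ M) c b → M ≡ []
    b-follows-c M          !l (inj₂ (inj₁ (c≡a , _)))          = ⊥-elim (Unique[x∷xs]⇒x∉xs !l (here (sym c≡a)))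
    b-follows-c M          !l (inj₂ (inj₂ (_ , b≡a)))          = ⊥-elim (a≢b (c ∷ M) !l (sym b≡a))
    b-follows-c M          !l (inj₁ (inj₁ (inj₁ (c≡a , _))))   = ⊥-elim (Unique[x∷xs]⇒x∉xs !l (here (sym c≡a)))
    b-follows-c M          !l (inj₁ (inj₁ (inj₂ (_ , b≡a))))   = ⊥-elim (a≢b (c ∷ M) !l (sym b≡a))
    b-follows-c []         !l (inj₁ (inj₂ _))                  = refl
    b-follows-c (m ∷ M)    !l (inj₁ (inj₂ (inj₁ (inj₁ (_ , b≡m))))) =
      ⊥-elim (Unique[x∷xs]⇒x∉xs (AllPairs.tail (AllPairs.tail !l)) (∈-++⁺ʳ M (here (sym b≡m))))
    b-follows-c (m ∷ M)    !l (inj₁ (inj₂ (inj₁ (inj₂ (c≡m , _))))) =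
      ⊥-elim (Unique[x∷xs]⇒x∉xs (AllPairs.tail !l) (here c≡m))
    b-follows-c (m ∷ M)    !l (inj₁ (inj₂ (inj₂ e))) =
      ⊥-elim (Unique[x∷xs]⇒x∉xs (AllPairs.tail !l) (proj₁ (PathEdges-∈ (m ∷ M ++ [ b ]) e)))

    -- The neighbours of a on the cycle are its successor and b, so c follows a, and then b follows c.
    inner≡[c] : ∀ M → Unique (a ∷ M ++ [ b ]) → Edges M a c → Edges M c b → M ≡ [ c ]
    inner≡[c] M       !l (inj₂ (inj₁ (_ , refl)))          cb = ⊥-elim (irreflexive M !l cb refl)
    inner≡[c] M       !l (inj₂ (inj₂ (a≡b , _)))          _  = ⊥-elim (a≢b M !l a≡b)
    inner≡[c] []      !l (inj₁ (inj₁ (inj₁ (_ , refl))))  cb = ⊥-elim (irreflexive [] !l cb refl)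
    inner≡[c] []      !l (inj₁ (inj₁ (inj₂ (a≡b , _))))  _  = ⊥-elim (a≢b [] !l a≡b)
    inner≡[c] (m ∷ M) !l (inj₁ (inj₁ (inj₁ (_ , refl))))  cb = cong (m ∷_) (b-follows-c M !l cb)
    inner≡[c] (m ∷ M) !l (inj₁ (inj₁ (inj₂ (a≡m , _))))  _  = ⊥-elim (Unique[x∷xs]⇒x∉xs !l (here a≡m))
    inner≡[c] (m ∷ M) !l (inj₁ (inj₂ e))                  _  =
      ⊥-elim (Unique[x∷xs]⇒x∉xs !l (proj₁ (PathEdges-∈ (m ∷ M ++ [ b ]) e)))

  Cycle-reverse : ∀ {s t} → Cycle s t → Cycle t s
  Cycle-reverse {s} {t} C = record
    { inner    = reverse (inner C)
    ; inner≢[] = λ eq → inner≢[] C (trans (sym (reverse-involutive (inner C))) (cong reverse eq))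
    ; distinct = subst Unique (reverse-vertices s (inner C) t) (Unique-resp-↭ (↭-sym (↭-reverse _)) (distinct C))
    }

  Cycle-reverse-edges : ∀ {s t} (C : Cycle s t) → edges (Cycle-reverse C) ⇔ edges C
  Cycle-reverse-edges {s} {t} C = to , from
    where
    to : edges (Cycle-reverse C) ⇒ edges C
    to (inj₁ e) = inj₁ (PathEdges-reverse⁻ (vertices C) (PathEdges-≡ (sym (reverse-vertices s (inner C) t)) e))
    to (inj₂ e) = inj₂ (Link-comm e)
    from : edges C ⇒ edges (Cycle-reverse C)
    from (inj₁ e) = inj₁ (PathEdges-≡ (reverse-vertices s (inner C) t) (PathEdges-reverse⁺ (vertices C) e))
    from (inj₂ e) = inj₂ (Link-comm e)

  module _ {s t : A} (C : Cycle s t) {p a b q} (split : vertices C ≡ p ++ a ∷ b ∷ q) where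

    private
      rotated≡ : b ∷ (q ++ p) ++ [ a ] ≡ (b ∷ q) ++ (p ++ [ a ])
      rotated≡ = cong (b ∷_) (++-assoc q p [ a ])
      vertices≡ : vertices C ≡ (p ++ [ a ]) ++ (b ∷ q)
      vertices≡ = trans split (sym (++-assoc p [ a ] (b ∷ q)))

      rotated≢[] : q ++ p ≢ []
      rotated≢[] qp≡[] with ++-conicalˡ q p qp≡[] | ++-conicalʳ q p qp≡[]
      ... | refl | refl = inner≢[] C (∷ʳ-injectiveˡ (inner C) [] (∷-injectiveʳ split))

    Cycle-rotate : Cycle b a
    Cycle-rotate = record
      { inner    = q ++ p
      ; inner≢[] = rotated≢[]
      ; distinct = subst Unique (sym rotated≡)
                     (Unique-resp-↭ (++-comm (p ++ [ a ]) (b ∷ q)) (subst Unique vertices≡ (distinct C)))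
      }

    Cycle-rotate-edges : edges Cycle-rotate ⇔ edges C
    Cycle-rotate-edges = to , from
      where
      to : edges Cycle-rotate ⇒ edges C
      to e = proj₁ (RingEdges-closing s (inner C) t)
               (RingEdges-≡ (sym vertices≡) (RingEdges-rotate (b ∷ q) (p ++ [ a ])
                 (RingEdges-≡ rotated≡ (proj₂ (RingEdges-closing b (q ++ p) a) e))))
      from : edges C ⇒ edges Cycle-rotate
      from e = proj₁ (RingEdges-closing b (q ++ p) a)
                 (RingEdges-≡ (sym rotated≡) (RingEdges-rotate (p ++ [ a ]) (b ∷ q)
                   (RingEdges-≡ vertices≡ (proj₂ (RingEdges-closing s (inner C) t) e))))

  reroot : ∀ {s₀ t₀ s t} (C : Cycle s₀ t₀) → edges C s t → Σ (Cycle s t) λ C′ → edges C′ ⇔ edges C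
  reroot C (inj₂ (inj₁ (refl , refl))) = C , id , id
  reroot C (inj₂ (inj₂ (refl , refl))) = Cycle-reverse C , Cycle-reverse-edges C
  reroot C (inj₁ e) with PathEdges-∃ (vertices C) e
  ... | p , a , b , q , split , inj₂ (refl , refl) = Cycle-rotate C split , Cycle-rotate-edges C split
  ... | p , a , b , q , split , inj₁ (refl , refl) =
    Cycle-reverse (Cycle-rotate C split) , ⇔-trans (Cycle-reverse-edges (Cycle-rotate C split)) (Cycle-rotate-edges C split)

  vertices-∷∷∷ : ∀ (s : A) (M : List A) t → M ≢ [] → ∃₂ λ (a b : A) → ∃₂ λ (c : A) (r : List A) → s ∷ M ++ [ t ] ≡ a ∷ b ∷ c ∷ r
  vertices-∷∷∷ s []           t M≢[] = ⊥-elim (M≢[] refl)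
  vertices-∷∷∷ s (m ∷ [])     t _    = s , m , t , [] , refl
  vertices-∷∷∷ s (m ∷ m′ ∷ M) t _    = s , m , m′ , M ++ [ t ] , refl

-- Cycles as enumerations Fin (m + 3) → Fin n

next-inject₁ : ∀ {k} (j : Fin k) → next (inject₁ j) ≡ suc j
next-inject₁ {k} j with k ℕ.≟ toℕ (inject₁ j)
... | yes k≡j = ⊥-elim (toℕ-inject₁-≢ j k≡j)
... | no k≢j  = cong suc (lower₁-inject₁′ j k≢j)

next-fromℕ : ∀ k → next (fromℕ k) ≡ zero
next-fromℕ k with k ℕ.≟ toℕ (fromℕ k)
... | yes _   = refl
... | no k≢k  = ⊥-elim (k≢k (sym (toℕ-fromℕ k)))

fromℕ-or-inject₁ : ∀ {k} (i : Fin (suc k)) → i ≡ fromℕ k ⊎ ∃ λ j → i ≡ inject₁ j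
fromℕ-or-inject₁ {zero}  zero    = inj₁ refl
fromℕ-or-inject₁ {suc k} zero    = inj₂ (zero , refl)
fromℕ-or-inject₁ {suc k} (suc i) with fromℕ-or-inject₁ i
... | inj₁ refl       = inj₁ refl
... | inj₂ (j , refl) = inj₂ (suc j , refl)

module _ {A : Set} where

  PathLinks : ∀ {k} → (Fin (suc k) → A) → Rel A 0ℓ
  PathLinks {k} g u v = ∃ λ (j : Fin k) → Link (g (inject₁ j)) (g (suc j)) u v

  PathEdges-tabulate : ∀ k (g : Fin (suc k) → A) → PathEdges (tabulate g) ⇔ PathLinks g
  PathEdges-tabulate k g = to k g , from k g
    where
    to : ∀ k (g : Fin (suc k) → A) → PathEdges (tabulate g) ⇒ PathLinks g
    to (suc k) g (inj₁ e) = zero , e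
    to (suc k) g (inj₂ e) with to k (g ∘ suc) e
    ... | j , e′ = suc j , e′
    from : ∀ k (g : Fin (suc k) → A) → PathLinks g ⇒ PathEdges (tabulate g)
    from (suc k) g (zero  , e) = inj₁ e
    from (suc k) g (suc j , e) = inj₂ (from k (g ∘ suc) (j , e))

  CyclicLinks : ∀ {k} → (Fin (suc k) → A) → Rel A 0ℓ
  CyclicLinks f u v = ∃ λ i → Link (f i) (f (next i)) u v

  RingEdges-tabulate : ∀ k (f : Fin (suc k) → A) → RingEdges (tabulate f) ⇔ CyclicLinks f
  RingEdges-tabulate k f = to , from
    where
    unrolled : tabulate f ++ [ f zero ] ≡ tabulate (f ∘ inject₁) ++ f (fromℕ k) ∷ [ f zero ]
    unrolled = trans (cong (_++ [ f zero ]) (tabulate-∷ʳ k f))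
                     (++-assoc (tabulate (f ∘ inject₁)) [ f (fromℕ k) ] [ f zero ])
    path⇔ : PathEdges (tabulate f) ⇔ PathLinks f
    path⇔ = PathEdges-tabulate k f
    to : RingEdges (tabulate f) ⇒ CyclicLinks f
    to e with PathEdges-split (tabulate (f ∘ inject₁)) (PathEdges-≡ unrolled e)
    ... | inj₂ (inj₁ e′) = fromℕ k , Link-≡ʳ (cong f (sym (next-fromℕ k))) e′
    ... | inj₁ e′ with proj₁ path⇔ (PathEdges-≡ (sym (tabulate-∷ʳ k f)) e′)
    ...   | j , e″ = inject₁ j , Link-≡ʳ (cong f (sym (next-inject₁ j))) e″
    from : CyclicLinks f ⇒ RingEdges (tabulate f)
    from (i , e) with fromℕ-or-inject₁ i
    ... | inj₁ refl = PathEdges-≡ (sym unrolled) (PathEdges-join (tabulate (f ∘ inject₁))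
                        (inj₂ (inj₁ (Link-≡ʳ (cong f (next-fromℕ k)) e))))
    ... | inj₂ (j , refl) = PathEdges-≡ (sym unrolled) (PathEdges-join (tabulate (f ∘ inject₁))
                        (inj₁ (PathEdges-≡ (tabulate-∷ʳ k f)
                          (proj₂ path⇔ (j , Link-≡ʳ (cong f (next-inject₁ j)) e)))))

module _ {n : ℕ} where

  Cycle⇒IsCycleEdgeSet : ∀ {S : Rel (Fin n) 0ℓ} {s t} (C : Cycle s t) → S ⇔ edges C → IsCycleEdgeSet S
  Cycle⇒IsCycleEdgeSet {S} {s} {t} C (S⇒C , C⇒S) = enumerate (vertices-∷∷∷ s (inner C) t (inner≢[] C))
    where
    enumerate : (∃₂ λ (a b : Fin n) → ∃₂ λ (c : Fin n) r → vertices C ≡ a ∷ b ∷ c ∷ r) → IsCycleEdgeSet S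
    enumerate (a , b , c , r , eq) = _ , f , lookup-injective (subst Unique eq (distinct C)) , closed , covered
      where
      L : List (Fin n)
      L = a ∷ b ∷ c ∷ r
      f : Fin (suc (suc (suc _))) → Fin n
      f = lookup L
      ring⇔ : RingEdges (tabulate f) ⇔ CyclicLinks f
      ring⇔ = RingEdges-tabulate _ f
      closed : ∀ i → S (f i) (f (next i))
      closed i = C⇒S (proj₁ (RingEdges-closing s (inner C) t)
                   (RingEdges-≡ (trans (tabulate-lookup L) (sym eq)) (proj₂ ring⇔ (i , inj₁ (refl , refl)))))
      covered : ∀ u v → S u v → ∃ λ i → (u ≡ f i × v ≡ f (next i)) ⊎ (v ≡ f i × u ≡ f (next i))
      covered u v uv with proj₁ ring⇔ (RingEdges-≡ (trans eq (sym (tabulate-lookup L)))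
                                        (proj₂ (RingEdges-closing s (inner C) t) (S⇒C uv)))
      ... | i , e = i , map₂ Product.swap e

  IsCycleEdgeSet⇒Cycle : ∀ {S : Rel (Fin n) 0ℓ} → IsCycleEdgeSet S → Symmetric S →
                         ∀ {s t} → S s t → Σ (Cycle s t) λ C → S ⇔ edges C
  IsCycleEdgeSet⇒Cycle {S} (m , f , f-inj , closed , covered) S-sym {s} {t} st = rerooted (reroot C₀ (proj₁ S⇔C₀ st))
    where
    vertices≡ : f zero ∷ tabulate (f ∘ suc ∘ inject₁) ++ [ f (fromℕ (suc (suc m))) ] ≡ tabulate f
    vertices≡ = cong (f zero ∷_) (sym (tabulate-∷ʳ (suc m) (f ∘ suc)))
    C₀ : Cycle (f zero) (f (fromℕ (suc (suc m))))
    C₀ = record { inner = tabulate (f ∘ suc ∘ inject₁) ; inner≢[] = λ () ; distinct = subst Unique (sym vertices≡) (tabulate⁺ f-inj) }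
    ring⇔ : RingEdges (tabulate f) ⇔ CyclicLinks f
    ring⇔ = RingEdges-tabulate _ f
    closing⇔ : RingEdges (vertices C₀) ⇔ edges C₀
    closing⇔ = RingEdges-closing (f zero) (inner C₀) (f (fromℕ (suc (suc m))))
    S⇔C₀ : S ⇔ edges C₀
    S⇔C₀ = (λ uv → proj₁ closing⇔ (RingEdges-≡ (sym vertices≡) (proj₂ ring⇔ (link (covered _ _ uv)))))
         , (λ e → S-link (proj₁ ring⇔ (RingEdges-≡ vertices≡ (proj₂ closing⇔ e))))
      where
      link : ∀ {u v} → (∃ λ i → (u ≡ f i × v ≡ f (next i)) ⊎ (v ≡ f i × u ≡ f (next i))) → CyclicLinks f u v
      link (i , e) = i , map₂ Product.swap e
      S-link : CyclicLinks f ⇒ S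
      S-link (i , inj₁ (refl , refl)) = closed i
      S-link (i , inj₂ (refl , refl)) = S-sym (closed i)
    rerooted : Σ (Cycle s t) (λ C → edges C ⇔ edges C₀) → Σ (Cycle s t) λ C → S ⇔ edges C
    rerooted (C , C⇔C₀) = C , ⇔-trans S⇔C₀ (Product.swap C⇔C₀)

  IsCycleEdgeSet-resp-⇔ : ∀ {S S′ : Rel (Fin n) 0ℓ} → S ⇔ S′ → IsCycleEdgeSet S → IsCycleEdgeSet S′
  IsCycleEdgeSet-resp-⇔ (S⇒S′ , S′⇒S) (m , f , f-inj , closed , covered) =
    m , f , f-inj , (λ i → S⇒S′ (closed i)) , (λ u v e → covered u v (S′⇒S e))

-- Recombining a triangle with the cycles through its neighbour

module _ {A : Set} where

  record CycleSplitting (T K : Rel A 0ℓ) : Set where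
    field
      {s₁ t₁ s₂ t₂} : A
      first    : Cycle s₁ t₁
      second   : Cycle s₂ t₂
      cover    : edges first ∪ edges second ⇔ T ∪ K
      disjoint : Disjoint (edges first) (edges second)
      first∩T  : Meets (edges first) T
      second∩T : Meets (edges second) T

  CycleSplitting-resp : ∀ {T T′ K} → T ⇔ T′ → CycleSplitting T K → CycleSplitting T′ K
  CycleSplitting-resp (T⇒T′ , T′⇒T) D = record
    { first    = first
    ; second   = second
    ; cover    = (λ e → map₁ T⇒T′ (proj₁ cover e)) , (λ e → proj₂ cover (map₁ T′⇒T e))
    ; disjoint = disjoint
    ; first∩T  = Product.map₂ (Product.map₂ (Product.map₂ T⇒T′)) first∩T
    ; second∩T = Product.map₂ (Product.map₂ (Product.map₂ T⇒T′)) second∩T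
    }
    where open CycleSplitting D

  triangle-meets-cycle-in-two :
    ∀ {z u v y : A} {p q} (C : Cycle z y) → vertices C ≡ z ∷ p ++ u ∷ q ++ [ y ] → v ∉ vertices C →
    Disjoint (Triangle z u v) (edges C) → CycleSplitting (Triangle z u v) (edges C)
  triangle-meets-cycle-in-two {z} {u} {v} {y} {p} {q} C vertices≡ v∉C T∩C = record
    { first    = first
    ; second   = second
    ; cover    = to , from
    ; disjoint = disjoint
    ; first∩T  = u , v , inj₂ (inj₂ (refl , refl)) , inj₂ (inj₁ (inj₁ (refl , refl)))
    ; second∩T = z , u , inj₁ (inj₁ (inj₁ (refl , refl))) , inj₁ (inj₁ (refl , refl))
    }
    where
    F : List A
    F = z ∷ p ++ u ∷ q ++ [ y ]
    !F : Unique F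
    !F = subst Unique vertices≡ (distinct C)
    F-edge : PathEdges F ⇒ edges C
    F-edge e = inj₁ (PathEdges-≡ (sym vertices≡) e)

    prefix : z ∷ p ++ [ u ] ⊆ F
    prefix = ++⁺ (⊆-refl {x = z ∷ p}) (++⁺ʳ (q ++ [ y ]) ⊆-refl)
    suffix : z ∷ u ∷ q ++ [ y ] ⊆ F
    suffix = refl Sublist.∷ ++⁺ˡ p ⊆-refl

    first : Cycle v u
    first = record
      { inner    = z ∷ p
      ; inner≢[] = λ ()
      ; distinct = Unique-∷ (λ v∈ → v∉C (subst (v ∈_) (sym vertices≡) (Any-resp-⊆ prefix v∈))) (Unique-resp-⊇ prefix !F)
      }
    second : Cycle z y
    second = record { inner = u ∷ q ; inner≢[] = λ () ; distinct = Unique-resp-⊇ suffix !F }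

    to : edges first ∪ edges second ⇒ Triangle z u v ∪ edges C
    to (inj₁ (inj₁ (inj₁ vz))) = inj₁ (inj₂ (inj₂ (Link-comm vz)))
    to (inj₁ (inj₁ (inj₂ e)))  = inj₂ (F-edge (PathEdges-join (z ∷ p) (inj₁ e)))
    to (inj₁ (inj₂ vu))        = inj₁ (inj₂ (inj₁ (Link-comm vu)))
    to (inj₂ (inj₁ (inj₁ zu))) = inj₁ (inj₁ zu)
    to (inj₂ (inj₁ (inj₂ e)))  = inj₂ (F-edge (PathEdges-join (z ∷ p) (inj₂ e)))
    to (inj₂ (inj₂ zy))        = inj₂ (inj₂ zy)

    from : Triangle z u v ∪ edges C ⇒ edges first ∪ edges second
    from (inj₁ (inj₁ zu))        = inj₂ (inj₁ (inj₁ zu))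
    from (inj₁ (inj₂ (inj₁ uv))) = inj₁ (inj₂ (Link-comm uv))
    from (inj₁ (inj₂ (inj₂ zv))) = inj₁ (inj₁ (inj₁ (Link-comm zv)))
    from (inj₂ (inj₂ zy))        = inj₂ (inj₂ zy)
    from (inj₂ (inj₁ e)) with PathEdges-split (z ∷ p) (PathEdges-≡ vertices≡ e)
    ... | inj₁ e′ = inj₁ (inj₁ (inj₂ e′))
    ... | inj₂ e′ = inj₂ (inj₁ (inj₂ e′))

    v∉second : v ∉ vertices second
    v∉second v∈ = v∉C (subst (v ∈_) (sym vertices≡) (Any-resp-⊆ suffix v∈))

    disjoint : Disjoint (edges first) (edges second)
    disjoint (inj₁ (inj₁ vz)) e₂                 = Link∉ (edges-∈ second) v∉second vz e₂
    disjoint (inj₂ vu)        e₂                 = Link∉ (edges-∈ second) v∉second vu e₂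
    disjoint (inj₁ (inj₂ e))  (inj₁ (inj₁ zu))  = T∩C (inj₁ zu) (F-edge (PathEdges-join (z ∷ p) (inj₁ e)))
    disjoint (inj₁ (inj₂ e))  (inj₁ (inj₂ e′))  = PathEdges-halves-disjoint (z ∷ p) !F e e′
    disjoint (inj₁ (inj₂ e))  (inj₂ zy)         =
      closing-disjoint C (PathEdges-≡ (sym vertices≡) (PathEdges-join (z ∷ p) (inj₁ e))) zy

  triangle-meets-cycle-in-three :
    ∀ {z u v y : A} {p q r} (C : Cycle z y) → vertices C ≡ z ∷ p ++ u ∷ q ++ v ∷ r ++ [ y ] →
    Disjoint (Triangle z u v) (edges C) → CycleSplitting (Triangle z u v) (edges C)
  triangle-meets-cycle-in-three {z} {u} {v} {y} {p} {q} {r} C vertices≡ T∩C = record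
    { first    = first
    ; second   = second
    ; cover    = to , from
    ; disjoint = disjoint
    ; first∩T  = u , v , first-edge (inj₁ (inj₁ (refl , refl))) , inj₂ (inj₁ (inj₁ (refl , refl)))
    ; second∩T = z , u , inj₁ (inj₁ (inj₁ (refl , refl))) , inj₁ (inj₁ (refl , refl))
    }
    where
    F : List A
    F = z ∷ p ++ u ∷ q ++ v ∷ r ++ [ y ]
    !F : Unique F
    !F = subst Unique vertices≡ (distinct C)
    z∉uv : z ∉ u ∷ [ v ]
    z∉uv = Unique[x∷xs]⇒x∉xs !F ∘ Any-resp-⊆ (++⁺ˡ p (refl Sublist.∷ ++⁺ˡ q (refl Sublist.∷ minimum _)))

    P Q R K₁ : Rel A 0ℓ
    P  = PathEdges (z ∷ p ++ [ u ])
    Q  = PathEdges (u ∷ q ++ [ v ])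
    R  = PathEdges (v ∷ r ++ [ y ])
    K₁ = P ∪ R ∪ Link z y

    F-path : P ∪ Q ∪ R ⇒ PathEdges (vertices C)
    F-path e = PathEdges-≡ (sym vertices≡) (PathEdges-join (z ∷ p) (join-at-v e))
      where
      join-at-v : P ∪ Q ∪ R ⇒ P ∪ PathEdges (u ∷ q ++ v ∷ r ++ [ y ])
      join-at-v (inj₁ e)        = inj₁ e
      join-at-v (inj₂ (inj₁ e)) = inj₂ (PathEdges-join (u ∷ q) (inj₁ e))
      join-at-v (inj₂ (inj₂ e)) = inj₂ (PathEdges-join (u ∷ q) (inj₂ e))
    F-edge : P ∪ Q ∪ R ⇒ edges C
    F-edge e = inj₁ (F-path e)
    F-parts : PathEdges (vertices C) ⇒ P ∪ Q ∪ R
    F-parts e with PathEdges-split (z ∷ p) (PathEdges-≡ vertices≡ e)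
    ... | inj₁ e′ = inj₁ e′
    ... | inj₂ e′ = inj₂ (PathEdges-split (u ∷ q) e′)
    K₁-edge : K₁ ⇒ edges C
    K₁-edge (inj₁ e)        = F-edge (inj₁ e)
    K₁-edge (inj₂ (inj₁ e)) = F-edge (inj₂ (inj₂ e))
    K₁-edge (inj₂ (inj₂ e)) = inj₂ e

    first-vertices≡ : z ∷ (p ++ u ∷ v ∷ r) ++ [ y ] ≡ z ∷ p ++ u ∷ v ∷ r ++ [ y ]
    first-vertices≡ = cong (z ∷_) (++-assoc p (u ∷ v ∷ r) [ y ])

    first : Cycle z y
    first = record
      { inner    = p ++ u ∷ v ∷ r
      ; inner≢[] = ++-∷≢[] p
      ; distinct = subst Unique (sym first-vertices≡)
                     (Unique-resp-⊇ (refl Sublist.∷ ++⁺ (⊆-refl {x = p}) (refl Sublist.∷ ++⁺ˡ q ⊆-refl)) !F)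
      }
    second : Cycle z v
    second = record
      { inner    = u ∷ q
      ; inner≢[] = λ ()
      ; distinct = Unique-resp-⊇ (refl Sublist.∷ ++⁺ˡ p (refl Sublist.∷ ++⁺ (⊆-refl {x = q}) (++⁺ʳ (r ++ [ y ]) ⊆-refl))) !F
      }

    first-path : P ∪ PathEdges (u ∷ v ∷ r ++ [ y ]) ⇒ edges first
    first-path e = inj₁ (PathEdges-≡ (sym first-vertices≡) (PathEdges-join (z ∷ p) e))
    first-edge : Link u v ∪ K₁ ⇒ edges first
    first-edge (inj₁ uv)               = first-path (inj₂ (inj₁ uv))
    first-edge (inj₂ (inj₁ e))         = first-path (inj₁ e)
    first-edge (inj₂ (inj₂ (inj₁ e)))  = first-path (inj₂ (inj₂ e))
    first-edge (inj₂ (inj₂ (inj₂ zy))) = inj₂ zy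
    first-parts : edges first ⇒ Link u v ∪ K₁
    first-parts (inj₂ zy) = inj₂ (inj₂ (inj₂ zy))
    first-parts (inj₁ e) with PathEdges-split (z ∷ p) (PathEdges-≡ first-vertices≡ e)
    ... | inj₁ e′         = inj₂ (inj₁ e′)
    ... | inj₂ (inj₁ uv)  = inj₁ uv
    ... | inj₂ (inj₂ e′)  = inj₂ (inj₂ (inj₁ e′))

    to : edges first ∪ edges second ⇒ Triangle z u v ∪ edges C
    to (inj₁ e) with first-parts e
    ... | inj₁ uv = inj₁ (inj₂ (inj₁ uv))
    ... | inj₂ k  = inj₂ (K₁-edge k)
    to (inj₂ (inj₁ (inj₁ zu))) = inj₁ (inj₁ zu)
    to (inj₂ (inj₁ (inj₂ e)))  = inj₂ (F-edge (inj₂ (inj₁ e)))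
    to (inj₂ (inj₂ zv))        = inj₁ (inj₂ (inj₂ zv))

    from : Triangle z u v ∪ edges C ⇒ edges first ∪ edges second
    from (inj₁ (inj₁ zu))        = inj₂ (inj₁ (inj₁ zu))
    from (inj₁ (inj₂ (inj₁ uv))) = inj₁ (first-edge (inj₁ uv))
    from (inj₁ (inj₂ (inj₂ zv))) = inj₂ (inj₂ zv)
    from (inj₂ (inj₂ zy))        = inj₁ (first-edge (inj₂ (inj₂ (inj₂ zy))))
    from (inj₂ (inj₁ e)) with F-parts e
    ... | inj₁ e′        = inj₁ (first-edge (inj₂ (inj₁ e′)))
    ... | inj₂ (inj₁ e′) = inj₂ (inj₁ (inj₂ e′))
    ... | inj₂ (inj₂ e′) = inj₁ (first-edge (inj₂ (inj₂ (inj₁ e′))))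

    disjoint : Disjoint (edges first) (edges second)
    disjoint e₁ e₂ with first-parts e₁ | e₂
    ... | inj₁ uv | inj₁ (inj₁ zu) = Link∉ (PathEdges-∈ (u ∷ [ v ])) z∉uv zu (inj₁ uv)
    ... | inj₁ uv | inj₂ zv        = Link∉ (PathEdges-∈ (u ∷ [ v ])) z∉uv zv (inj₁ uv)
    ... | inj₁ uv | inj₁ (inj₂ e)  = T∩C (inj₂ (inj₁ uv)) (F-edge (inj₂ (inj₁ e)))
    ... | inj₂ k  | inj₁ (inj₁ zu) = T∩C (inj₁ zu) (K₁-edge k)
    ... | inj₂ k  | inj₂ zv        = T∩C (inj₂ (inj₂ zv)) (K₁-edge k)
    ... | inj₂ (inj₁ e)        | inj₁ (inj₂ e′) = PathEdges-halves-disjoint (z ∷ p) !F e (PathEdges-join (u ∷ q) (inj₁ e′))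
    ... | inj₂ (inj₂ (inj₁ e)) | inj₁ (inj₂ e′) =
      PathEdges-halves-disjoint (u ∷ q) (Unique-resp-⊇ (++⁺ˡ (z ∷ p) ⊆-refl) !F) e′ e
    ... | inj₂ (inj₂ (inj₂ zy)) | inj₁ (inj₂ e′) = closing-disjoint C (F-path (inj₂ (inj₁ e′))) zy

  triangle-meets-two-cycles :
    ∀ {x₁ x₂ x₃ y : A} (Cₐ : Cycle x₁ y) (C_b : Cycle x₂ y) →
    x₂ ∉ vertices Cₐ → x₃ ∉ vertices Cₐ → x₁ ∉ vertices C_b → x₃ ∉ vertices C_b →
    Disjoint (Triangle x₁ x₂ x₃) (edges Cₐ) → Disjoint (Triangle x₁ x₂ x₃) (edges C_b) → Disjoint (edges Cₐ) (edges C_b) →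
    CycleSplitting (Triangle x₁ x₂ x₃) (edges Cₐ ∪ edges C_b)
  triangle-meets-two-cycles {x₁} {x₂} {x₃} {y} Cₐ C_b x₂∉Cₐ x₃∉Cₐ x₁∉C_b x₃∉C_b T∩Cₐ T∩C_b Cₐ∩C_b = record
    { first    = first
    ; second   = second
    ; cover    = to , from
    ; disjoint = disjoint
    ; first∩T  = x₂ , x₁ , inj₁ (inj₁ (inj₁ (refl , refl))) , inj₁ (inj₂ (refl , refl))
    ; second∩T = x₂ , x₃ , inj₁ (inj₂ (inj₁ (inj₂ (refl , refl)))) , inj₂ (inj₁ (inj₁ (refl , refl)))
    }
    where
    first : Cycle x₂ y
    first = record { inner = x₁ ∷ inner Cₐ ; inner≢[] = λ () ; distinct = Unique-∷ x₂∉Cₐ (distinct Cₐ) }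

    x₁∉ : x₁ ∉ x₃ ∷ vertices C_b
    x₁∉ (here x₁≡x₃) = x₃∉Cₐ (here (sym x₁≡x₃))
    x₁∉ (there x₁∈)  = x₁∉C_b x₁∈
    second : Cycle x₁ y
    second = record { inner = x₃ ∷ x₂ ∷ inner C_b ; inner≢[] = λ () ; distinct = Unique-∷ x₁∉ (Unique-∷ x₃∉C_b (distinct C_b)) }

    to : edges first ∪ edges second ⇒ Triangle x₁ x₂ x₃ ∪ edges Cₐ ∪ edges C_b
    to (inj₁ (inj₁ (inj₁ x₂x₁)))          = inj₁ (inj₁ (Link-comm x₂x₁))
    to (inj₁ (inj₁ (inj₂ e)))             = inj₂ (inj₁ (inj₁ e))
    to (inj₁ (inj₂ x₂y))                  = inj₂ (inj₂ (inj₂ x₂y))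
    to (inj₂ (inj₁ (inj₁ x₁x₃)))          = inj₁ (inj₂ (inj₂ x₁x₃))
    to (inj₂ (inj₁ (inj₂ (inj₁ x₃x₂))))   = inj₁ (inj₂ (inj₁ (Link-comm x₃x₂)))
    to (inj₂ (inj₁ (inj₂ (inj₂ e))))      = inj₂ (inj₂ (inj₁ e))
    to (inj₂ (inj₂ x₁y))                  = inj₂ (inj₁ (inj₂ x₁y))

    from : Triangle x₁ x₂ x₃ ∪ edges Cₐ ∪ edges C_b ⇒ edges first ∪ edges second
    from (inj₁ (inj₁ x₁x₂))        = inj₁ (inj₁ (inj₁ (Link-comm x₁x₂)))
    from (inj₁ (inj₂ (inj₁ x₂x₃))) = inj₂ (inj₁ (inj₂ (inj₁ (Link-comm x₂x₃))))
    from (inj₁ (inj₂ (inj₂ x₁x₃))) = inj₂ (inj₁ (inj₁ x₁x₃))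
    from (inj₂ (inj₁ (inj₁ e)))    = inj₁ (inj₁ (inj₂ e))
    from (inj₂ (inj₁ (inj₂ x₁y)))  = inj₂ (inj₂ x₁y)
    from (inj₂ (inj₂ (inj₁ e)))    = inj₂ (inj₁ (inj₂ (inj₂ e)))
    from (inj₂ (inj₂ (inj₂ x₂y)))  = inj₁ (inj₂ x₂y)

    second-T : Link x₁ x₃ ∪ Link x₃ x₂ ⇒ Triangle x₁ x₂ x₃
    second-T (inj₁ x₁x₃) = inj₂ (inj₂ x₁x₃)
    second-T (inj₂ x₃x₂) = inj₂ (inj₁ (Link-comm x₃x₂))

    x₃∉x₂x₁ : x₃ ∉ x₂ ∷ [ x₁ ]
    x₃∉x₂x₁ (here x₃≡x₂)         = x₃∉C_b (here x₃≡x₂)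
    x₃∉x₂x₁ (there (here x₃≡x₁)) = x₃∉Cₐ (here x₃≡x₁)

    disjoint : Disjoint (edges first) (edges second)
    disjoint (inj₁ (inj₁ x₂x₁)) (inj₁ (inj₁ x₁x₃))        = Link∉ (PathEdges-∈ (x₂ ∷ [ x₁ ])) x₃∉x₂x₁ (Link-comm x₁x₃) (inj₁ x₂x₁)
    disjoint (inj₁ (inj₁ x₂x₁)) (inj₁ (inj₂ (inj₁ x₃x₂))) = Link∉ (PathEdges-∈ (x₂ ∷ [ x₁ ])) x₃∉x₂x₁ x₃x₂ (inj₁ x₂x₁)
    disjoint (inj₁ (inj₁ x₂x₁)) (inj₁ (inj₂ (inj₂ e)))    = T∩C_b (inj₁ (Link-comm x₂x₁)) (inj₁ e)
    disjoint (inj₁ (inj₁ x₂x₁)) (inj₂ x₁y)                = T∩Cₐ (inj₁ (Link-comm x₂x₁)) (inj₂ x₁y)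
    disjoint (inj₁ (inj₂ e))    (inj₁ (inj₁ x₁x₃))        = T∩Cₐ (second-T (inj₁ x₁x₃)) (inj₁ e)
    disjoint (inj₁ (inj₂ e))    (inj₁ (inj₂ (inj₁ x₃x₂))) = T∩Cₐ (second-T (inj₂ x₃x₂)) (inj₁ e)
    disjoint (inj₁ (inj₂ e))    (inj₁ (inj₂ (inj₂ e′)))   = Cₐ∩C_b (inj₁ e) (inj₁ e′)
    disjoint (inj₁ (inj₂ e))    (inj₂ x₁y)                = closing-disjoint Cₐ e x₁y
    disjoint (inj₂ x₂y)         (inj₁ (inj₁ x₁x₃))        = T∩C_b (second-T (inj₁ x₁x₃)) (inj₂ x₂y)
    disjoint (inj₂ x₂y)         (inj₁ (inj₂ (inj₁ x₃x₂))) = T∩C_b (second-T (inj₂ x₃x₂)) (inj₂ x₂y)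
    disjoint (inj₂ x₂y)         (inj₁ (inj₂ (inj₂ e′)))   = closing-disjoint C_b e′ x₂y
    disjoint (inj₂ x₂y)         (inj₂ x₁y)                = Cₐ∩C_b (inj₂ x₁y) (inj₂ x₂y)

module _ {A : Set} (_≟_ : DecidableEquality A) where


  open import Data.List.Membership.DecPropositional _≟_ using (_∈?_)

  Link? : ∀ a b → Decidable (Link a b)
  Link? a b u v = (u ≟ a ×-dec v ≟ b) ⊎-dec (u ≟ b ×-dec v ≟ a)

  PathEdges? : ∀ l → Decidable (PathEdges l)
  PathEdges? []          u v = no λ ()
  PathEdges? (a ∷ [])    u v = no λ ()
  PathEdges? (a ∷ b ∷ l) u v = Link? a b u v ⊎-dec PathEdges? (b ∷ l) u v

  edges? : ∀ {s t} (C : Cycle s t) → Decidable (edges C)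
  edges? {s} {t} C u v = PathEdges? (vertices C) u v ⊎-dec Link? s t u v

  triangle-meets-cycle :
    ∀ {z u v y : A} (C : Cycle z y) → u ∈ inner C → u ≢ v → v ≢ z → v ≢ y →
    Disjoint (Triangle z u v) (edges C) → CycleSplitting (Triangle z u v) (edges C)
  triangle-meets-cycle {z} {u} {v} {y} C u∈ u≢v v≢z v≢y T∩C with v ∈? inner C
  ... | no v∉ with ∈-split [ y ] u∈
  ...   | p , q , eq = triangle-meets-cycle-in-two C (cong (z ∷_) eq) (∉-vertices C v≢z v∉ v≢y) T∩C
  triangle-meets-cycle {z} {u} {v} {y} C u∈ u≢v v≢z v≢y T∩C | yes v∈ with ∈-split₂ [ y ] u∈ v∈ u≢v
  ...   | inj₁ (p , q , r , eq) = triangle-meets-cycle-in-three C (cong (z ∷_) eq) T∩C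
  ...   | inj₂ (p , q , r , eq) = CycleSplitting-resp (Triangle-swap₂₃ , Triangle-swap₂₃)
                                    (triangle-meets-cycle-in-three C (cong (z ∷_) eq) (T∩C ∘ Triangle-swap₂₃))

-- Recolouring two edge-disjoint cycles

does-⇔ : ∀ {P Q : Set} → (P → Q) → (Q → P) → (P? : Dec P) (Q? : Dec Q) → does P? ≡ does Q?
does-⇔ P→Q Q→P (yes p) (yes q) = refl
does-⇔ P→Q Q→P (yes p) (no ¬q) = ⊥-elim (¬q (P→Q p))
does-⇔ P→Q Q→P (no ¬p) (yes q) = ⊥-elim (¬p (Q→P q))
does-⇔ P→Q Q→P (no ¬p) (no ¬q) = refl

Colour : ℕ → Set
Colour n = Fin (numColours n)

module _ {n : ℕ} {H : Graph n} where

  ColouredIn : EdgeColouring H → U.Pred (Colour n) 0ℓ → Rel (Fin n) 0ℓ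
  ColouredIn c O u v = Σ (Adj H u v) λ e → O (col c u v e)

  ColouredIn-∪ : ∀ (c : EdgeColouring H) {P Q : U.Pred (Colour n) 0ℓ} → ColouredIn c (P U.∪ Q) ⇔ ColouredIn c P ∪ ColouredIn c Q
  ColouredIn-∪ c = (λ { (e , inj₁ x) → inj₁ (e , x) ; (e , inj₂ x) → inj₂ (e , x) })
                 , (λ { (inj₁ (e , x)) → e , inj₁ x ; (inj₂ (e , x)) → e , inj₂ x })

  col-irrelevant : (c : EdgeColouring H) → ∀ {u v} (e e′ : Adj H u v) → col c u v e ≡ col c u v e′
  col-irrelevant c {u} {v} e e′ = trans (colSym c u v e (symAdj H e)) (sym (colSym c u v e′ (symAdj H e)))

  col-Link : ∀ (c : EdgeColouring H) {a b} (ab : Adj H a b) {u v} (e : Adj H u v) → Link a b u v → col c u v e ≡ col c a b ab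
  col-Link c ab e (inj₁ (refl , refl)) = col-irrelevant c e ab
  col-Link c ab e (inj₂ (refl , refl)) = colSym c _ _ e ab

  ColourClass-sym : (c : EdgeColouring H) → ∀ {i} → Symmetric (ColourClass c i)
  ColourClass-sym c {i} {u} {v} (e , col≡i) = symAdj H e , trans (sym (colSym c u v e (symAdj H e))) col≡i

  ColourClass-disjoint : ∀ (c : EdgeColouring H) {i j} → i ≢ j → Disjoint (ColourClass c i) (ColourClass c j)
  ColourClass-disjoint c i≢j (e , col≡i) (e′ , col≡j) = i≢j (trans (sym col≡i) (trans (col-irrelevant c e e′) col≡j))

  module Recolouring (c : EdgeColouring H) (legal : Legal c) {O : U.Pred (Colour n) 0ℓ} (O? : U.Decidable O)
                     {p q : Colour n} (p∈O : O p) (q∈O : O q) (p≢q : p ≢ q)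
                     {s₁ t₁ s₂ t₂} (C₁ : Cycle s₁ t₁) (C₂ : Cycle s₂ t₂)
                     (cover : edges C₁ ∪ edges C₂ ⇔ ColouredIn c O) (disjoint : Disjoint (edges C₁) (edges C₂)) where

    choose : Bool → Bool → Colour n → Colour n
    choose true  _     _ = p
    choose false true  _ = q
    choose false false j = j

    recolour : Fin n → Fin n → Colour n → Colour n
    recolour u v = choose (does (edges? _≟ᶠ_ C₁ u v)) (does (edges? _≟ᶠ_ C₂ u v))

    recolour-sym : ∀ u v j → recolour u v j ≡ recolour v u j
    recolour-sym u v j = cong₂ (λ b₁ b₂ → choose b₁ b₂ j) (does-sym C₁) (does-sym C₂)
      where
      does-sym : ∀ {s t} (C : Cycle s t) → does (edges? _≟ᶠ_ C u v) ≡ does (edges? _≟ᶠ_ C v u)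
      does-sym C = does-⇔ (edges-sym C) (edges-sym C) (edges? _≟ᶠ_ C u v) (edges? _≟ᶠ_ C v u)

    col′ : (u v : Fin n) → Adj H u v → Colour n
    col′ u v e = recolour u v (col c u v e)

    c′ : EdgeColouring H
    c′ = record
      { col    = col′
      ; colSym = λ u v e e′ → trans (cong (recolour u v) (colSym c u v e e′)) (recolour-sym u v (col c v u e′))
      }

    col′-C₁ : ∀ {u v} (e : Adj H u v) → edges C₁ u v → col′ u v e ≡ p
    col′-C₁ {u} {v} e h = cong (λ b → choose b _ _) (dec-true (edges? _≟ᶠ_ C₁ u v) h)

    col′-C₂ : ∀ {u v} (e : Adj H u v) → edges C₂ u v → col′ u v e ≡ q
    col′-C₂ {u} {v} e h = cong₂ (λ b₁ b₂ → choose b₁ b₂ _)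
                            (dec-false (edges? _≟ᶠ_ C₁ u v) (λ h₁ → disjoint h₁ h)) (dec-true (edges? _≟ᶠ_ C₂ u v) h)

    col′-other : ∀ {u v} (e : Adj H u v) → ¬ edges C₁ u v → ¬ edges C₂ u v → col′ u v e ≡ col c u v e
    col′-other {u} {v} e ¬h₁ ¬h₂ = cong₂ (λ b₁ b₂ → choose b₁ b₂ _)
                                     (dec-false (edges? _≟ᶠ_ C₁ u v) ¬h₁) (dec-false (edges? _≟ᶠ_ C₂ u v) ¬h₂)

    outside : ∀ {u v} (e : Adj H u v) → ¬ edges C₁ u v → ¬ edges C₂ u v → ¬ O (col c u v e)
    outside e ¬h₁ ¬h₂ Oj = [ ¬h₁ , ¬h₂ ]′ (proj₂ cover (e , Oj))

    class′ : ∀ {j u v} → ColourClass c′ j u v →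
             (edges C₁ u v × p ≡ j) ⊎ (edges C₂ u v × q ≡ j) ⊎ (ColourClass c j u v × ¬ O j)
    class′ {j} {u} {v} (e , col′≡j) with edges? _≟ᶠ_ C₁ u v | edges? _≟ᶠ_ C₂ u v
    ... | yes h₁ | _      = inj₁ (h₁ , trans (sym (col′-C₁ e h₁)) col′≡j)
    ... | no ¬h₁ | yes h₂ = inj₂ (inj₁ (h₂ , trans (sym (col′-C₂ e h₂)) col′≡j))
    ... | no ¬h₁ | no ¬h₂ = inj₂ (inj₂ ((e , col≡j) , λ Oj → outside e ¬h₁ ¬h₂ (subst O (sym col≡j) Oj)))
      where
      col≡j : col c u v e ≡ j
      col≡j = trans (sym (col′-other e ¬h₁ ¬h₂)) col′≡j

    adjacent : edges C₁ ∪ edges C₂ ⇒ Adj H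
    adjacent h = proj₁ (proj₁ cover h)

    class′-p : ColourClass c′ p ⇔ edges C₁
    class′-p = to , λ h → adjacent (inj₁ h) , col′-C₁ _ h
      where
      to : ColourClass c′ p ⇒ edges C₁
      to e with class′ e
      ... | inj₁ (h , _)              = h
      ... | inj₂ (inj₁ (_ , q≡p))     = ⊥-elim (p≢q (sym q≡p))
      ... | inj₂ (inj₂ (_ , ¬O))      = ⊥-elim (¬O p∈O)

    class′-q : ColourClass c′ q ⇔ edges C₂
    class′-q = to , λ h → adjacent (inj₂ h) , col′-C₂ _ h
      where
      to : ColourClass c′ q ⇒ edges C₂
      to e with class′ e
      ... | inj₁ (_ , p≡q)            = ⊥-elim (p≢q p≡q)
      ... | inj₂ (inj₁ (h , _))       = h
      ... | inj₂ (inj₂ (_ , ¬O))      = ⊥-elim (¬O q∈O)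

    class′-unchanged : ∀ {j} → ¬ O j → ColourClass c′ j ⇔ ColourClass c j
    class′-unchanged {j} ¬Oj = to , from
      where
      to : ColourClass c′ j ⇒ ColourClass c j
      to e with class′ e
      ... | inj₁ (_ , refl)        = ⊥-elim (¬Oj p∈O)
      ... | inj₂ (inj₁ (_ , refl)) = ⊥-elim (¬Oj q∈O)
      ... | inj₂ (inj₂ (e′ , _))   = e′
      from : ColourClass c j ⇒ ColourClass c′ j
      from {u} {v} (e , col≡j) = e , trans (col′-other e ¬h₁ ¬h₂) col≡j
        where
        ¬in : edges C₁ u v ⊎ edges C₂ u v → ⊥
        ¬in h with proj₁ cover h
        ... | e′ , Oe′ = ¬Oj (subst O (trans (col-irrelevant c e′ e) col≡j) Oe′)
        ¬h₁ : ¬ edges C₁ u v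
        ¬h₁ h = ¬in (inj₁ h)
        ¬h₂ : ¬ edges C₂ u v
        ¬h₂ h = ¬in (inj₂ h)

    legal′ : Legal c′
    legal′ j (u , v , e) with j ≟ᶠ p | j ≟ᶠ q | O? j
    ... | yes refl | _        | _      = Cycle⇒IsCycleEdgeSet C₁ class′-p
    ... | no _     | yes refl | _      = Cycle⇒IsCycleEdgeSet C₂ class′-q
    ... | no j≢p   | no j≢q   | yes Oj with class′ e
    ...   | inj₁ (_ , p≡j)        = ⊥-elim (j≢p (sym p≡j))
    ...   | inj₂ (inj₁ (_ , q≡j)) = ⊥-elim (j≢q (sym q≡j))
    ...   | inj₂ (inj₂ (_ , ¬Oj)) = ⊥-elim (¬Oj Oj)
    legal′ j (u , v , e) | no _ | no _ | no ¬Oj =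
      IsCycleEdgeSet-resp-⇔ (Product.swap (class′-unchanged ¬Oj)) (legal j (u , v , proj₁ (class′-unchanged ¬Oj) e))

  Polychromatic : EdgeColouring H → Rel (Fin n) 0ℓ → Set
  Polychromatic c T = ∃₂ λ j k → j ≢ k × Meets T (ColourClass c j) × Meets T (ColourClass c k)

  recolour-splitting : ∀ (c : EdgeColouring H) → Legal c → ∀ {O : U.Pred (Colour n) 0ℓ} → U.Decidable O →
                       ∀ {p q} → O p → O q → p ≢ q → ∀ {T K} → CycleSplitting T K → T ∪ K ⇔ ColouredIn c O →
                       Σ (EdgeColouring H) λ c′ → Legal c′ × Polychromatic c′ T
  recolour-splitting c legal O? {p} {q} p∈O q∈O p≢q D T∪K⇔O = c′ , legal′ , p , q , p≢q , meets first∩T class′-p , meets second∩T class′-q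
    where
    open CycleSplitting D
    open Recolouring c legal O? p∈O q∈O p≢q first second (⇔-trans cover T∪K⇔O) disjoint
    meets : ∀ {E S T} → Meets E T → S ⇔ E → Meets T S
    meets (u , v , e , t) (_ , E⇒S) = u , v , t , E⇒S e

module _ {n : ℕ} (H : Graph n) where

  Link-adj : ∀ {a b} → Adj H a b → Link a b ⇒ Adj H
  Link-adj ab (inj₁ (refl , refl)) = ab
  Link-adj ab (inj₂ (refl , refl)) = symAdj H ab

  Adj-≢ : ∀ {u v} → Adj H u v → u ≢ v
  Adj-≢ e refl = irrefl H e

-- The triangle x₁x₂x₃ with a common neighbour y

module K₄ {n : ℕ} (H : Graph n) {x₁ x₂ x₃ y : Fin n}
          (a₁₂ : Adj H x₁ x₂) (a₁₃ : Adj H x₁ x₃) (a₂₃ : Adj H x₂ x₃)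
          (a₁y : Adj H x₁ y) (a₂y : Adj H x₂ y) (a₃y : Adj H x₃ y) where

  open import Data.List.Membership.DecPropositional (_≟ᶠ_ {n}) using (_∈?_)

  T : Rel (Fin n) 0ℓ
  T = Triangle x₁ x₂ x₃

  Monochromatic : EdgeColouring H → Set
  Monochromatic c = col c x₁ x₂ a₁₂ ≡ col c x₂ x₃ a₂₃ × col c x₂ x₃ a₂₃ ≡ col c x₁ x₃ a₁₃

  monochromatic? : ∀ c → Dec (Monochromatic c)
  monochromatic? c = (col c x₁ x₂ a₁₂ ≟ᶠ col c x₂ x₃ a₂₃) ×-dec (col c x₂ x₃ a₂₃ ≟ᶠ col c x₁ x₃ a₁₃)

  T-adj : T ⇒ Adj H
  T-adj (inj₁ e)        = Link-adj H a₁₂ e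
  T-adj (inj₂ (inj₁ e)) = Link-adj H a₂₃ e
  T-adj (inj₂ (inj₂ e)) = Link-adj H a₁₃ e

  monochromatic-edge : ∀ c → Monochromatic c → ∀ {u v} (e : Adj H u v) → T u v → col c u v e ≡ col c x₁ x₂ a₁₂
  monochromatic-edge c mono        e (inj₁ l)        = col-Link c a₁₂ e l
  monochromatic-edge c (m₁ , m₂)   e (inj₂ (inj₁ l)) = trans (col-Link c a₂₃ e l) (sym m₁)
  monochromatic-edge c (m₁ , m₂)   e (inj₂ (inj₂ l)) = trans (col-Link c a₁₃ e l) (sym (trans m₁ m₂))

  Polychromatic⇒¬Monochromatic : ∀ c → Polychromatic c T → ¬ Monochromatic c
  Polychromatic⇒¬Monochromatic c (j , k , j≢k , (_ , _ , t , e , col≡j) , (_ , _ , t′ , e′ , col≡k)) mono =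
    j≢k (trans (sym col≡j) (trans (monochromatic-edge c mono e t) (trans (sym (monochromatic-edge c mono e′ t′)) col≡k)))

  x₁≢x₂ : x₁ ≢ x₂
  x₁≢x₂ = Adj-≢ H a₁₂

  x₁≢x₃ : x₁ ≢ x₃
  x₁≢x₃ = Adj-≢ H a₁₃

  x₂≢x₃ : x₂ ≢ x₃
  x₂≢x₃ = Adj-≢ H a₂₃

  x₁≢y : x₁ ≢ y
  x₁≢y = Adj-≢ H a₁y

  x₂≢y : x₂ ≢ y
  x₂≢y = Adj-≢ H a₂y

  x₃≢y : x₃ ≢ y
  x₃≢y = Adj-≢ H a₃y

  y∉T : ∀ {u} → ¬ T u y
  y∉T t with Triangle-∈ t
  ... | here y≡x₁                 = x₁≢y (sym y≡x₁)
  ... | there (here y≡x₂)         = x₂≢y (sym y≡x₂)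
  ... | there (there (here y≡x₃)) = x₃≢y (sym y≡x₃)


  module MonochromaticCase (c : EdgeColouring H) (legal : Legal c) (mono : Monochromatic c) where

    i a b : Colour n
    i = col c x₁ x₂ a₁₂
    a = col c x₁ y a₁y
    b = col c x₂ y a₂y

    colour-cycle : ∀ {u v} (e : Adj H u v) → Σ (Cycle u v) λ C → ColourClass c (col c u v e) ⇔ edges C
    colour-cycle {u} {v} e = IsCycleEdgeSet⇒Cycle (legal _ (u , v , e , refl)) (ColourClass-sym c) (e , refl)

    T⇒class-i : T ⇒ ColourClass c i
    T⇒class-i t = T-adj t , monochromatic-edge c mono _ t

    class-i⇔T : ColourClass c i ⇔ T
    class-i⇔T = (λ e → cycle-through-triangle Cᵢ (class⇒Cᵢ (T⇒class-i x₁x₃)) (class⇒Cᵢ (T⇒class-i x₃x₂)) (class⇒Cᵢ e)) , T⇒class-i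
      where
      Cᵢ : Cycle x₁ x₂
      Cᵢ = proj₁ (colour-cycle a₁₂)
      class⇒Cᵢ : ColourClass c i ⇒ edges Cᵢ
      class⇒Cᵢ = proj₁ (proj₂ (colour-cycle a₁₂))
      x₁x₃ : T x₁ x₃
      x₁x₃ = inj₂ (inj₂ (inj₁ (refl , refl)))
      x₃x₂ : T x₃ x₂
      x₃x₂ = inj₂ (inj₁ (inj₂ (refl , refl)))

    i≢a : i ≢ a
    i≢a i≡a = y∉T (proj₁ class-i⇔T (a₁y , sym i≡a))
    i≢b : i ≢ b
    i≢b i≡b = y∉T (proj₁ class-i⇔T (a₂y , sym i≡b))

    Cₐ : Cycle x₁ y
    Cₐ = proj₁ (colour-cycle a₁y)
    C_b : Cycle x₂ y
    C_b = proj₁ (colour-cycle a₂y)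
    class-a⇔Cₐ : ColourClass c a ⇔ edges Cₐ
    class-a⇔Cₐ = proj₂ (colour-cycle a₁y)
    class-b⇔C_b : ColourClass c b ⇔ edges C_b
    class-b⇔C_b = proj₂ (colour-cycle a₂y)

    T∩Cₐ : Disjoint T (edges Cₐ)
    T∩Cₐ t e = ColourClass-disjoint c i≢a (T⇒class-i t) (proj₂ class-a⇔Cₐ e)
    T∩C_b : Disjoint T (edges C_b)
    T∩C_b t e = ColourClass-disjoint c i≢b (T⇒class-i t) (proj₂ class-b⇔C_b e)

    Result : Set
    Result = Σ (EdgeColouring H) λ c′ → Legal c′ × Polychromatic c′ T

    recolour-with-class : ∀ {j K} → i ≢ j → ColourClass c j ⇔ K → CycleSplitting T K → Result
    recolour-with-class {j} i≢j class-j⇔K D =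
      recolour-splitting c legal O? (inj₁ refl) (inj₂ refl) i≢j D
        (⇔-trans (∪-⇔ (Product.swap class-i⇔T) (Product.swap class-j⇔K)) (Product.swap (ColouredIn-∪ c {_≡ i} {_≡ j})))
      where
      O? : U.Decidable ((_≡ i) U.∪ (_≡ j))
      O? = (_≟ᶠ i) ∪? (_≟ᶠ j)

    recolour-with-both-classes : x₂ ∉ inner Cₐ → x₃ ∉ inner Cₐ → x₁ ∉ inner C_b → x₃ ∉ inner C_b → Result
    recolour-with-both-classes x₂∉ x₃∉ x₁∉ x₃∉′ =
      recolour-splitting c legal O? (inj₁ refl) (inj₂ (inj₁ refl)) i≢a
        (triangle-meets-two-cycles Cₐ C_b x₂∉Cₐ x₃∉Cₐ x₁∉C_b x₃∉C_b T∩Cₐ T∩C_b Cₐ∩C_b)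
        (⇔-trans (∪-⇔ (Product.swap class-i⇔T) (∪-⇔ (Product.swap class-a⇔Cₐ) (Product.swap class-b⇔C_b)))
                 (Product.swap (⇔-trans (ColouredIn-∪ c {_≡ i} {(_≡ a) U.∪ (_≡ b)}) (∪-⇔ (id , id) (ColouredIn-∪ c {_≡ a} {_≡ b})))))
      where
      O? : U.Decidable ((_≡ i) U.∪ (_≡ a) U.∪ (_≡ b))
      O? = (_≟ᶠ i) ∪? (_≟ᶠ a) ∪? (_≟ᶠ b)
      x₂∉Cₐ : x₂ ∉ vertices Cₐ
      x₂∉Cₐ = ∉-vertices Cₐ (≢-sym x₁≢x₂) x₂∉ x₂≢y
      x₃∉Cₐ : x₃ ∉ vertices Cₐ
      x₃∉Cₐ = ∉-vertices Cₐ (≢-sym x₁≢x₃) x₃∉ x₃≢y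
      x₁∉C_b : x₁ ∉ vertices C_b
      x₁∉C_b = ∉-vertices C_b x₁≢x₂ x₁∉ x₁≢y
      x₃∉C_b : x₃ ∉ vertices C_b
      x₃∉C_b = ∉-vertices C_b (≢-sym x₂≢x₃) x₃∉′ x₃≢y
      a≢b : a ≢ b
      a≢b a≡b = x₂∉Cₐ (proj₁ (edges-∈ Cₐ (proj₁ class-a⇔Cₐ (a₂y , sym a≡b))))
      Cₐ∩C_b : Disjoint (edges Cₐ) (edges C_b)
      Cₐ∩C_b e e′ = ColourClass-disjoint c a≢b (proj₂ class-a⇔Cₐ e) (proj₂ class-b⇔C_b e′)

    recolouring : Result
    recolouring with x₂ ∈? inner Cₐ | x₃ ∈? inner Cₐ | x₁ ∈? inner C_b | x₃ ∈? inner C_b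
    ... | yes x₂∈ | _ | _ | _ = recolour-with-class i≢a class-a⇔Cₐ (triangle-meets-cycle _≟ᶠ_ Cₐ x₂∈ x₂≢x₃ (≢-sym x₁≢x₃) x₃≢y T∩Cₐ)
    ... | no _ | yes x₃∈ | _ | _ = recolour-with-class i≢a class-a⇔Cₐ
          (CycleSplitting-resp (Triangle-swap₂₃ , Triangle-swap₂₃)
            (triangle-meets-cycle _≟ᶠ_ Cₐ x₃∈ (≢-sym x₂≢x₃) (≢-sym x₁≢x₂) x₂≢y (T∩Cₐ ∘ Triangle-swap₂₃)))
    ... | no _ | no _ | yes x₁∈ | _ = recolour-with-class i≢b class-b⇔C_b
          (CycleSplitting-resp (Triangle-swap₁₂ , Triangle-swap₁₂)
            (triangle-meets-cycle _≟ᶠ_ C_b x₁∈ x₁≢x₃ (≢-sym x₂≢x₃) x₃≢y (T∩C_b ∘ Triangle-swap₁₂)))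
    ... | no _ | no _ | no _ | yes x₃∈ = recolour-with-class i≢b class-b⇔C_b
          (CycleSplitting-resp (Triangle-swap₁₂ ∘ Triangle-swap₂₃ , Triangle-swap₂₃ ∘ Triangle-swap₁₂)
            (triangle-meets-cycle _≟ᶠ_ C_b x₃∈ (≢-sym x₁≢x₃) x₁≢x₂ x₁≢y (T∩C_b ∘ Triangle-swap₁₂ ∘ Triangle-swap₂₃)))
    ... | no x₂∉ | no x₃∉ | no x₁∉ | no x₃∉′ = recolour-with-both-classes x₂∉ x₃∉ x₁∉ x₃∉′

lemma3p1 : ∀ {n} (H : Graph n) (c : EdgeColouring H) → Legal c →
    (x₁ x₂ x₃ y : Fin n) →
    (a₁₂ : Adj H x₁ x₂) (a₁₃ : Adj H x₁ x₃) (a₂₃ : Adj H x₂ x₃) →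
    Adj H x₁ y → Adj H x₂ y → Adj H x₃ y →
    Σ (EdgeColouring H) λ c' → Legal c' ×
      ¬ (col c' x₁ x₂ a₁₂ ≡ col c' x₂ x₃ a₂₃ × col c' x₂ x₃ a₂₃ ≡ col c' x₁ x₃ a₁₃)
lemma3p1 H c legal x₁ x₂ x₃ y a₁₂ a₁₃ a₂₃ a₁y a₂y a₃y = decide (monochromatic? c)
  where
  open K₄ H a₁₂ a₁₃ a₂₃ a₁y a₂y a₃y

  decide : Dec (Monochromatic c) → Σ (EdgeColouring H) λ c′ → Legal c′ × ¬ Monochromatic c′
  decide (no ¬mono) = c , legal , ¬mono
  decide (yes mono) with MonochromaticCase.recolouring c legal mono
  ... | c′ , legal′ , poly = c′ , legal′ , Polychromatic⇒¬Monochromatic c′ poly
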